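{- Let $A=(a_{j,i})\in\mathbb{Z}^{m\times n}$ and $\vec b=(b_1,\dots,b_m)\in\mathbb{Z}^m$. For every solution $\vec s\in\mathbb{N}^n$ of $A\vec x=\vec b$ (with $n$ variables) there is a graph $G\in\mathcal{G}[A\vec x=\vec b]$ with $sol(G)=\vec s$ whose path-width is at most $2n$.
   Context: Solutions of an integer linear programming (ILP) instance $A\vec x=\vec b$ are vectors of nonnegative integers. Set $a_{j,0}:=-b_j$ for $j\in[1,m]$. The class $\mathcal{G}[A\vec x=\vec b]$ consists of finite labelled (multi)graphs $G=(V,E,\{V_i\}_{i\in[0,n]},\{E_j\}_{j\in[1,m]})$ where $\{V_i\}_{i\in[0,n]}$ partitions the vertex set $V$ (a vertex in $V_i$ is "labelled by variable $i$"), $V_0$ consists of exactly one vertex, and $\{E_j\}_{j\in[1,m]}$ partitions the edge set $E$ (an edge in $E_j$ is "labelled by constraint $j$"), such that for every $j\in[1,m]$: every edge of $E_j$ joins a vertex labelled $i$ with $a_{j,i}>0$ to a vertex labelled $i'$ with $a_{j,i'}<0$, and every vertex labelled $i$ is incident to exactly $|a_{j,i}|$ edges of $E_j$. For such $G$, $sol(G)=(|V_1|,\dots,|V_n|)$; every $sol(G)$ is a solution of $A\vec x=\vec b$. Path-width is the usual path-width of the underlying graph. -}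

module Defs where

open import Data.Nat using (ℕ; zero; suc; _≤_; _+_)
open import Data.Integer as ℤ using (ℤ; +_; -_; ∣_∣) renaming (_+_ to _+ℤ_; _*_ to _*ℤ_; _<_ to _<ℤ_)
open import Data.Fin as Fin using (Fin; zero; suc) renaming (_≤_ to _≤ᶠ_)
open import Data.Fin.Subset using (Subset; _∈_) renaming (∣_∣ to size)
open import Data.Product using (Σ; ∃; _×_; _,_; proj₁; proj₂)
open import Data.Sum using (_⊎_)
open import Data.Bool using (Bool; true; false; _∧_; _∨_)
open import Relation.Nullary.Decidable using (⌊_⌋)
open import Relation.Binary.PropositionalEquality using (_≡_)

count : (k : ℕ) → (Fin k → Bool) → ℕ
count zero    p = 0
count (suc k) p with p zero
... | true  = suc (count k (λ i → p (suc i)))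
... | false = count k (λ i → p (suc i))

sumℤ : (k : ℕ) → (Fin k → ℤ) → ℤ
sumℤ zero    f = + 0
sumℤ (suc k) f = f zero +ℤ sumℤ k (λ i → f (suc i))

Matrix : ℕ → ℕ → Set
Matrix m n = Fin m → Fin n → ℤ

IsSolution : {m n : ℕ} → Matrix m n → (Fin m → ℤ) → (Fin n → ℕ) → Set
IsSolution {m} {n} A b s = ∀ j → sumℤ n (λ i → A j i *ℤ + s i) ≡ b j

-- Extended coefficients: a_{j,0} = -b_j, a_{j,i} = A_{j,i} for i ∈ [1,n].
ext : {m n : ℕ} → Matrix m n → (Fin m → ℤ) → Fin m → Fin (suc n) → ℤ
ext A b j zero    = - b j
ext A b j (suc i) = A j i

-- A finite multigraph with vertices Fin N and edges Fin M, vertex labels in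
-- [0,n] (Fin (suc n)) and edge labels in [1,m] (Fin m).
record LGraph (n m : ℕ) : Set where
  field
    N    : ℕ
    M    : ℕ
    vlab : Fin N → Fin (suc n)
    ends : Fin M → Fin N × Fin N
    elab : Fin M → Fin m

open LGraph public

vcount : {n m : ℕ} → LGraph n m → Fin (suc n) → ℕ
vcount G i = count (N G) (λ v → ⌊ vlab G v Fin.≟ i ⌋)

degIn : {n m : ℕ} → (G : LGraph n m) → Fin m → Fin (N G) → ℕ
degIn G j v = count (M G) (λ e → ⌊ elab G e Fin.≟ j ⌋ ∧
                                  (⌊ proj₁ (ends G e) Fin.≟ v ⌋ ∨ ⌊ proj₂ (ends G e) Fin.≟ v ⌋))

InClass : {m n : ℕ} → Matrix m n → (Fin m → ℤ) → LGraph n m → Set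
InClass A b G =
    (vcount G zero ≡ 1)
  × (∀ e → let j = elab G e ; u = proj₁ (ends G e) ; w = proj₂ (ends G e) in
        ((+ 0 <ℤ ext A b j (vlab G u)) × (ext A b j (vlab G w) <ℤ + 0))
      ⊎ ((+ 0 <ℤ ext A b j (vlab G w)) × (ext A b j (vlab G u) <ℤ + 0)))
  × (∀ j v → degIn G j v ≡ ∣ ext A b j (vlab G v) ∣)

SolIs : {n m : ℕ} → LGraph n m → (Fin n → ℕ) → Set
SolIs G s = ∀ i → vcount G (suc i) ≡ s i

record PathDecomposition {n m : ℕ} (G : LGraph n m) : Set where
  field
    L       : ℕ
    bag     : Fin L → Subset (N G)
    vcover  : ∀ v → ∃ λ k → v ∈ bag k
    ecover  : ∀ e → ∃ λ k → (proj₁ (ends G e) ∈ bag k) × (proj₂ (ends G e) ∈ bag k)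
    interp  : ∀ v (k₁ k₂ k₃ : Fin L) → k₁ ≤ᶠ k₂ → k₂ ≤ᶠ k₃ →
              v ∈ bag k₁ → v ∈ bag k₃ → v ∈ bag k₂

-- Width = max bag size − 1; path-width ≤ w iff some decomposition has all bags of size ≤ w+1.
PathwidthAtMost : {n m : ℕ} → LGraph n m → ℕ → Set
PathwidthAtMost G w = Σ (PathDecomposition G) λ D →
  ∀ k → size (PathDecomposition.bag D k) ≤ w + 1

module Submission where

-- Give the constant term its own class 0 with s₀ = 1 vertex and view
-- the r-th of the s_i vertices of class i as the interval [r/s_i , (r+1)/s_i].
-- Write a_{j,i} = a⁺ − a⁻.  As s is a solution, row j has P_j = Σ a⁺ s_i =
-- Σ a⁻ s_i edges.  On the positive side vertex (i , r) owns a⁺_{j,i} cells;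
-- earliest-deadline-first scheduling (Hall's condition checked arithmetically)
-- places the P_j cells into slots p < P_j so that p/P_j lies in the interval of
-- the owner; likewise on the negative side, and edge (j , p) joins the owners
-- of slot p.  Degrees, signs and sol(G) = s hold by construction.  For a common
-- multiple D of all s_i and P_j, the bags B_g = {(i , r) | g/D ∈ [r/s_i , (r+1)/s_i]}
-- (g ≤ D) are convex in g, contain edge (j , p) at g = pD/P_j, and meet class i
-- in at most two vertices (class 0 in one): width ≤ 2n.

open import Defs
open import Data.Nat using (ℕ; _*_)
open import Data.Integer using (ℤ)
open import Data.Fin using (Fin)
open import Data.Product using (Σ; _×_)

open import Data.Nat
open import Data.Nat.Properties
open import Data.Nat.DivMod using (_/_; _%_; m≡m%n+[m/n]*n; m%n<n; m/n*n≤m; /-monoˡ-≤; m*n/n≡m)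
open import Data.Nat.Solver using (module +-*-Solver)
open import Data.Integer as ℤ using (ℤ; -[1+_]; -_; ∣_∣) renaming (_+_ to _+ℤ_; _*_ to _*ℤ_; _<_ to _<ℤ_)
import Data.Integer.Properties as ℤP
import Data.Integer.Solver as ℤSolver
open import Data.Fin as F using (Fin; zero; suc; toℕ; _↑ˡ_; _↑ʳ_; splitAt; fromℕ<)
import Data.Fin.Properties as FP
open import Data.Fin.Subset using (Subset; _∈_) renaming (∣_∣ to size)
import Data.Vec as Vec
import Data.Vec.Properties as VecP
open import Data.Bool using (Bool; true; false; _∧_; _∨_; not; T)
open import Data.Bool.Properties using (T-∧; T-∨; T-≡; ∨-identityʳ; ∧-identityʳ)
open import Data.Unit using (tt)
open import Data.Empty using (⊥; ⊥-elim)
open import Data.Product using (Σ; ∃; _×_; _,_; proj₁; proj₂)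
open import Data.Sum using (_⊎_; inj₁; inj₂)
open import Data.List using (List; []; _∷_; _++_; length; map)
open import Data.List.Relation.Unary.All as All using (All; []; _∷_)
open import Data.List.Relation.Unary.All.Properties using (++⁺; ++⁻; map⁺)
open import Data.List.Properties using (length-++; length-map; map-++; map-∘)
open import Function.Bundles using (Equivalence)
open import Relation.Nullary using (yes; no)
open import Relation.Nullary.Decidable using (⌊_⌋)
open import Relation.Binary.PropositionalEquality
open import Function using (_∘_)

open +-*-Solver using (solve; _:=_; _:+_; _:*_; con)
open Equivalence using (to; from)

bit : Bool → ℕ
bit true  = 1
bit false = 0

bit≤1 : ∀ b → bit b ≤ 1
bit≤1 true  = ≤-refl
bit≤1 false = z≤n

bit-mono : ∀ {a b} → (T a → T b) → bit a ≤ bit b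
bit-mono {false} f = z≤n
bit-mono {true} {true} f = ≤-refl
bit-mono {true} {false} f = ⊥-elim (f tt)

bit-∨ : ∀ a b → bit (a ∨ b) ≤ bit a + bit b
bit-∨ true  b = s≤s z≤n
bit-∨ false b = ≤-refl

T⇒≡true : ∀ {b} → T b → b ≡ true
T⇒≡true = to T-≡

count-suc : ∀ k (p : Fin (suc k) → Bool) → count (suc k) p ≡ bit (p zero) + count k (λ i → p (suc i))
count-suc k p with p zero
... | true  = refl
... | false = refl

count-ext : ∀ k {p q : Fin k → Bool} → (∀ i → p i ≡ q i) → count k p ≡ count k q
count-ext zero e = refl
count-ext (suc k) {p} {q} e rewrite count-suc k p | count-suc k q | e zero =
  cong (bit (q zero) +_) (count-ext k (λ i → e (suc i)))

count-none : ∀ k {p : Fin k → Bool} → (∀ i → p i ≡ false) → count k p ≡ 0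
count-none zero e = refl
count-none (suc k) {p} e rewrite count-suc k p | e zero = count-none k (λ i → e (suc i))

count-all : ∀ k {p : Fin k → Bool} → (∀ i → p i ≡ true) → count k p ≡ k
count-all zero e = refl
count-all (suc k) {p} e rewrite count-suc k p | e zero = cong suc (count-all k (λ i → e (suc i)))

count-≤ : ∀ k (p : Fin k → Bool) → count k p ≤ k
count-≤ zero p = z≤n
count-≤ (suc k) p rewrite count-suc k p = +-mono-≤ (bit≤1 (p zero)) (count-≤ k _)

count-mono : ∀ k {p q : Fin k → Bool} → (∀ i → T (p i) → T (q i)) → count k p ≤ count k q
count-mono zero f = z≤n
count-mono (suc k) {p} {q} f rewrite count-suc k p | count-suc k q =
  +-mono-≤ (bit-mono (f zero)) (count-mono k (λ i → f (suc i)))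

count-∨ : ∀ k (p q : Fin k → Bool) → count k (λ i → p i ∨ q i) ≤ count k p + count k q
count-∨ zero p q = z≤n
count-∨ (suc k) p q rewrite count-suc k (λ i → p i ∨ q i) | count-suc k p | count-suc k q =
  ≤-trans (+-mono-≤ (bit-∨ (p zero) (q zero)) (count-∨ k _ _))
          (≤-reflexive (solve 4 (λ a b c d → (a :+ b) :+ (c :+ d) := (a :+ c) :+ (b :+ d)) refl
                          (bit (p zero)) (bit (q zero)) (count k (λ i → p (suc i))) (count k (λ i → q (suc i)))))

count-+ : ∀ m n (p : Fin (m + n) → Bool) → count (m + n) p ≡ count m (λ i → p (i ↑ˡ n)) + count n (λ i → p (m ↑ʳ i))
count-+ zero n p = refl
count-+ (suc m) n p rewrite count-suc (m + n) p | count-suc m (λ i → p (i ↑ˡ n)) =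
  trans (cong (bit (p zero) +_) (count-+ m n (λ i → p (suc i)))) (sym (+-assoc (bit (p zero)) _ _))

count≡0⇒false : ∀ k {p : Fin k → Bool} → count k p ≡ 0 → ∀ i → p i ≡ false
count≡0⇒false (suc k) {p} e zero with p zero | count-suc k p
... | false | _  = refl
... | true  | e′ = ⊥-elim (1+n≢0 (trans (sym e′) e))
count≡0⇒false (suc k) {p} e (suc i) with p zero | count-suc k p
... | false | e′ = count≡0⇒false k (trans (sym e′) e) i
... | true  | e′ = ⊥-elim (1+n≢0 (trans (sym e′) e))

size-tabulate : ∀ k (p : Fin k → Bool) → size (Vec.tabulate p) ≡ count k p
size-tabulate zero p = refl
size-tabulate (suc k) p with p zero
... | true  = cong suc (size-tabulate k (λ i → p (suc i)))
... | false = size-tabulate k (λ i → p (suc i))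

sumF : (k : ℕ) → (Fin k → ℕ) → ℕ
sumF zero    f = 0
sumF (suc k) f = f zero + sumF k (λ i → f (suc i))

sumF-ext : ∀ k {f g : Fin k → ℕ} → (∀ i → f i ≡ g i) → sumF k f ≡ sumF k g
sumF-ext zero e = refl
sumF-ext (suc k) e = cong₂ _+_ (e zero) (sumF-ext k (λ i → e (suc i)))

sumF-mono : ∀ k {f g : Fin k → ℕ} → (∀ i → f i ≤ g i) → sumF k f ≤ sumF k g
sumF-mono zero e = z≤n
sumF-mono (suc k) e = +-mono-≤ (e zero) (sumF-mono k (λ i → e (suc i)))

sumF-const : ∀ k c → sumF k (λ _ → c) ≡ k * c
sumF-const zero c = refl
sumF-const (suc k) c = cong (c +_) (sumF-const k c)

sumF-+ : ∀ k (f g : Fin k → ℕ) → sumF k (λ i → f i + g i) ≡ sumF k f + sumF k g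
sumF-+ zero f g = refl
sumF-+ (suc k) f g rewrite sumF-+ k (λ i → f (suc i)) (λ i → g (suc i)) =
  solve 4 (λ a b c d → (a :+ b) :+ (c :+ d) := (a :+ c) :+ (b :+ d)) refl
    (f zero) (g zero) (sumF k (λ i → f (suc i))) (sumF k (λ i → g (suc i)))

sumF-*ˡ : ∀ k (c : ℕ) (f : Fin k → ℕ) → sumF k (λ i → c * f i) ≡ c * sumF k f
sumF-*ˡ zero c f = sym (*-zeroʳ c)
sumF-*ˡ (suc k) c f =
  trans (cong (c * f zero +_) (sumF-*ˡ k c (λ i → f (suc i)))) (sym (*-distribˡ-+ c (f zero) _))

sumF-single : ∀ k (f : Fin k → ℕ) i₀ → (∀ i → i ≢ i₀ → f i ≡ 0) → sumF k f ≡ f i₀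
sumF-single (suc k) f zero h =
  trans (cong (f zero +_) (trans (sumF-ext k (λ i → h (suc i) (λ ()))) (trans (sumF-const k 0) (*-zeroʳ k))))
        (+-identityʳ _)
sumF-single (suc k) f (suc i₀) h =
  trans (cong (_+ sumF k (λ i → f (suc i))) (h zero (λ ())))
        (sumF-single k (λ i → f (suc i)) i₀ (λ i i≢i₀ → h (suc i) (λ e → i≢i₀ (FP.suc-injective e))))

sumF-strict : ∀ k (X Y C : Fin k → ℕ) → (∀ i → (C i ≡ 0 × X i ≤ Y i) ⊎ X i < Y i) →
  sumF k C ≡ 0 ⊎ sumF k X < sumF k Y
sumF-strict zero X Y C h = inj₁ refl
sumF-strict (suc k) X Y C h
  with h zero | sumF-strict k (λ i → X (suc i)) (λ i → Y (suc i)) (λ i → C (suc i)) (λ i → h (suc i))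
... | inj₁ (C₀≡0 , _)  | inj₁ rest≡0 = inj₁ (cong₂ _+_ C₀≡0 rest≡0)
... | inj₁ (_ , X₀≤Y₀) | inj₂ rest<  = inj₂ (+-mono-≤-< X₀≤Y₀ rest<)
... | inj₂ X₀<Y₀       | _           = inj₂ (+-mono-<-≤ X₀<Y₀ (sumF-mono k (λ i → weak (h (suc i)))))
  where
  weak : ∀ {c x y} → (c ≡ 0 × x ≤ y) ⊎ x < y → x ≤ y
  weak (inj₁ (_ , x≤y)) = x≤y
  weak (inj₂ x<y)       = <⇒≤ x<y

prodF : (k : ℕ) → (Fin k → ℕ) → ℕ
prodF zero    f = 1
prodF (suc k) f = f zero * prodF k (λ i → f (suc i))

prodF-factor : ∀ k f i → Σ ℕ (λ K → prodF k f ≡ K * f i)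
prodF-factor (suc k) f zero = prodF k (λ i → f (suc i)) , *-comm (f zero) _
prodF-factor (suc k) f (suc i) with prodF-factor k (λ i → f (suc i)) i
... | K , eq = f zero * K , trans (cong (f zero *_) eq) (sym (*-assoc (f zero) K _))

prodF-nonZero : ∀ k f → (∀ i → NonZero (f i)) → NonZero (prodF k f)
prodF-nonZero zero f h = _
prodF-nonZero (suc k) f h = m*n≢0 (f zero) _ {{h zero}} {{prodF-nonZero k _ (λ i → h (suc i))}}

enc : ∀ k (f : Fin k → ℕ) (i : Fin k) → Fin (f i) → Fin (sumF k f)
enc (suc k) f zero    r = r ↑ˡ sumF k (λ i → f (suc i))
enc (suc k) f (suc i) r = f zero ↑ʳ enc k (λ i → f (suc i)) i r

dec : ∀ k (f : Fin k → ℕ) → Fin (sumF k f) → Σ (Fin k) (λ i → Fin (f i))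
dec (suc k) f x with splitAt (f zero) x
... | inj₁ r = zero , r
... | inj₂ y with dec k (λ i → f (suc i)) y
... | i , r = suc i , r

dec-enc : ∀ k f i r → dec k f (enc k f i r) ≡ (i , r)
dec-enc (suc k) f zero r rewrite FP.splitAt-↑ˡ (f zero) r (sumF k (λ i → f (suc i))) = refl
dec-enc (suc k) f (suc i) r
  rewrite FP.splitAt-↑ʳ (f zero) (sumF k (λ i → f (suc i))) (enc k (λ i → f (suc i)) i r)
        | dec-enc k (λ i → f (suc i)) i r = refl

enc-dec : ∀ k f x → enc k f (proj₁ (dec k f x)) (proj₂ (dec k f x)) ≡ x
enc-dec (suc k) f x with splitAt (f zero) x in eq
... | inj₁ r = FP.splitAt⁻¹-↑ˡ eq
... | inj₂ y with dec k (λ i → f (suc i)) y | enc-dec k (λ i → f (suc i)) y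
... | i , r | e = trans (cong (f zero ↑ʳ_) e) (FP.splitAt⁻¹-↑ʳ eq)

enc-injective₁ : ∀ k f {i i′ r r′} → enc k f i r ≡ enc k f i′ r′ → i ≡ i′
enc-injective₁ k f {i} {i′} {r} {r′} e =
  cong proj₁ (trans (sym (dec-enc k f i r)) (trans (cong (dec k f) e) (dec-enc k f i′ r′)))

enc-injective₂ : ∀ k f {i r r′} → enc k f i r ≡ enc k f i r′ → r ≡ r′
enc-injective₂ k f {i} {r} {r′} e = snd-injective (trans (sym (dec-enc k f i r)) (trans (cong (dec k f) e) (dec-enc k f i r′)))
  where
  snd-injective : ∀ {A : Set} {B : A → Set} {a : A} {x y : B a} → _≡_ {A = Σ A B} (a , x) (a , y) → x ≡ y
  snd-injective refl = refl

count-enc : ∀ k f (p : Fin (sumF k f) → Bool) →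
  count (sumF k f) p ≡ sumF k (λ i → count (f i) (λ r → p (enc k f i r)))
count-enc zero f p = refl
count-enc (suc k) f p =
  trans (count-+ (f zero) _ p)
        (cong (count (f zero) (λ r → p (r ↑ˡ _)) +_) (count-enc k (λ i → f (suc i)) (λ y → p (f zero ↑ʳ y))))

⌊≟⌋-refl : ∀ {k} (x : Fin k) → ⌊ x F.≟ x ⌋ ≡ true
⌊≟⌋-refl x with x F.≟ x
... | yes _   = refl
... | no x≢x  = ⊥-elim (x≢x refl)

⌊≟⌋-≢ : ∀ {k} {x y : Fin k} → x ≢ y → ⌊ x F.≟ y ⌋ ≡ false
⌊≟⌋-≢ {x = x} {y} x≢y with x F.≟ y
... | yes x≡y = ⊥-elim (x≢y x≡y)
... | no _    = refl

count-Σ : ∀ k f (q : Σ (Fin k) (λ i → Fin (f i)) → Bool) →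
  count (sumF k f) (λ x → q (dec k f x)) ≡ sumF k (λ i → count (f i) (λ r → q (i , r)))
count-Σ k f q = trans (count-enc k f (λ x → q (dec k f x)))
                      (sumF-ext k (λ i → count-ext (f i) (λ r → cong q (dec-enc k f i r))))

count-fibre : ∀ k f i₀ (q : Σ (Fin k) (λ i → Fin (f i)) → Bool) →
  count (sumF k f) (λ x → ⌊ proj₁ (dec k f x) F.≟ i₀ ⌋ ∧ q (dec k f x)) ≡ count (f i₀) (λ r → q (i₀ , r))
count-fibre k f i₀ q = begin
    count (sumF k f) (λ x → ⌊ proj₁ (dec k f x) F.≟ i₀ ⌋ ∧ q (dec k f x))
      ≡⟨ count-Σ k f (λ y → ⌊ proj₁ y F.≟ i₀ ⌋ ∧ q y) ⟩
    sumF k (λ i → count (f i) (λ r → ⌊ i F.≟ i₀ ⌋ ∧ q (i , r)))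
      ≡⟨ sumF-single k _ i₀ (λ i i≢i₀ → count-none (f i) (λ r → cong (_∧ q (i , r)) (⌊≟⌋-≢ i≢i₀))) ⟩
    count (f i₀) (λ r → ⌊ i₀ F.≟ i₀ ⌋ ∧ q (i₀ , r))
      ≡⟨ count-ext (f i₀) (λ r → cong (_∧ q (i₀ , r)) (⌊≟⌋-refl i₀)) ⟩
    count (f i₀) (λ r → q (i₀ , r)) ∎
  where open ≡-Reasoning

sumF-point : ∀ k f (g : Fin k → ℕ) i₀ r₀ →
  sumF k (λ i → sumF (f i) (λ r → bit ⌊ enc k f i r F.≟ enc k f i₀ r₀ ⌋ * g i)) ≡ g i₀
sumF-point k f g i₀ r₀ = begin
    sumF k (λ i → sumF (f i) (λ r → bit ⌊ enc k f i r F.≟ enc k f i₀ r₀ ⌋ * g i))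
      ≡⟨ sumF-single k _ i₀ other-class ⟩
    sumF (f i₀) (λ r → bit ⌊ enc k f i₀ r F.≟ enc k f i₀ r₀ ⌋ * g i₀)
      ≡⟨ sumF-single (f i₀) _ r₀ (λ r r≢r₀ → cong (λ b → bit b * g i₀) (⌊≟⌋-≢ (r≢r₀ ∘ enc-injective₂ k f))) ⟩
    bit ⌊ enc k f i₀ r₀ F.≟ enc k f i₀ r₀ ⌋ * g i₀
      ≡⟨ cong (λ b → bit b * g i₀) (⌊≟⌋-refl (enc k f i₀ r₀)) ⟩
    1 * g i₀
      ≡⟨ *-identityˡ (g i₀) ⟩
    g i₀ ∎
  where
  open ≡-Reasoning
  other-class : ∀ i → i ≢ i₀ → sumF (f i) (λ r → bit ⌊ enc k f i r F.≟ enc k f i₀ r₀ ⌋ * g i) ≡ 0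
  other-class i i≢i₀ = trans (sumF-ext (f i) (λ r → cong (λ b → bit b * g i) (⌊≟⌋-≢ (i≢i₀ ∘ enc-injective₁ k f))))
                             (trans (sumF-const (f i) 0) (*-zeroʳ (f i)))

countL : ∀ {J : Set} → (J → Bool) → List J → ℕ
countL p []       = 0
countL p (x ∷ xs) = bit (p x) + countL p xs

countL-++ : ∀ {J : Set} (p : J → Bool) xs ys → countL p (xs ++ ys) ≡ countL p xs + countL p ys
countL-++ p [] ys = refl
countL-++ p (x ∷ xs) ys = trans (cong (bit (p x) +_) (countL-++ p xs ys)) (sym (+-assoc (bit (p x)) _ _))

countL-map : ∀ {J K : Set} (p : K → Bool) (g : J → K) xs → countL p (map g xs) ≡ countL (λ x → p (g x)) xs
countL-map p g [] = refl
countL-map p g (x ∷ xs) = cong (bit (p (g x)) +_) (countL-map p g xs)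

countL-mono : ∀ {J : Set} {p q : J → Bool} {xs} → All (λ y → T (p y) → T (q y)) xs → countL p xs ≤ countL q xs
countL-mono [] = z≤n
countL-mono (f ∷ fs) = +-mono-≤ (bit-mono f) (countL-mono fs)

countL-const : ∀ {J : Set} (b : Bool) (xs : List J) → countL (λ _ → b) xs ≡ bit b * length xs
countL-const b [] = sym (*-zeroʳ (bit b))
countL-const b (x ∷ xs) = trans (cong (bit b +_) (countL-const b xs)) (sym (*-suc (bit b) (length xs)))

countL-all : ∀ {J : Set} {p : J → Bool} {xs} → All (λ y → T (p y)) xs → countL p xs ≡ length xs
countL-all [] = refl
countL-all {p = p} (px ∷ pxs) rewrite T⇒≡true px = cong suc (countL-all pxs)

countL-none : ∀ {J : Set} {p : J → Bool} {xs} → All (λ y → p y ≡ false) xs → countL p xs ≡ 0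
countL-none [] = refl
countL-none (e ∷ es) rewrite e = countL-none es

countL-remove : ∀ {J : Set} (p : J → Bool) pre x post →
  countL p (pre ++ x ∷ post) ≡ bit (p x) + countL p (pre ++ post)
countL-remove p pre x post rewrite countL-++ p pre post | countL-++ p pre (x ∷ post) =
  solve 3 (λ a b c → a :+ (b :+ c) := b :+ (a :+ c)) refl (countL p pre) (bit (p x)) (countL p post)

countL-remove-≤ : ∀ {J : Set} (p : J → Bool) pre x post → countL p (pre ++ post) ≤ countL p (pre ++ x ∷ post)
countL-remove-≤ p pre x post rewrite countL-remove p pre x post = m≤n+m _ (bit (p x))

concatF : ∀ {J : Set} k → (Fin k → List J) → List J
concatF zero    F = []
concatF (suc k) F = F zero ++ concatF k (λ i → F (suc i))

concatF-ext : ∀ {J : Set} k {F G : Fin k → List J} → (∀ i → F i ≡ G i) → concatF k F ≡ concatF k G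
concatF-ext zero e = refl
concatF-ext (suc k) e = cong₂ _++_ (e zero) (concatF-ext k (λ i → e (suc i)))

map-concatF : ∀ {J K : Set} (g : J → K) k (F : Fin k → List J) → map g (concatF k F) ≡ concatF k (λ i → map g (F i))
map-concatF g zero F = refl
map-concatF g (suc k) F = trans (map-++ g (F zero) _) (cong (map g (F zero) ++_) (map-concatF g k (λ i → F (suc i))))

length-concatF : ∀ {J : Set} k (F : Fin k → List J) → length (concatF k F) ≡ sumF k (λ i → length (F i))
length-concatF zero F = refl
length-concatF (suc k) F = trans (length-++ (F zero)) (cong (length (F zero) +_) (length-concatF k (λ i → F (suc i))))

countL-concatF : ∀ {J : Set} (p : J → Bool) k (F : Fin k → List J) → countL p (concatF k F) ≡ sumF k (λ i → countL p (F i))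
countL-concatF p zero F = refl
countL-concatF p (suc k) F = trans (countL-++ p (F zero) _) (cong (countL p (F zero) +_) (countL-concatF p k (λ i → F (suc i))))

All-concatF : ∀ {J : Set} {Q : J → Set} k (F : Fin k → List J) → (∀ i → All Q (F i)) → All Q (concatF k F)
All-concatF zero F h = []
All-concatF (suc k) F h = ++⁺ (h zero) (All-concatF k (λ i → F (suc i)) (λ i → h (suc i)))

run : ℕ → ℕ → List ℕ
run st zero    = []
run st (suc l) = st ∷ run (suc st) l

length-run : ∀ st l → length (run st l) ≡ l
length-run st zero = refl
length-run st (suc l) = cong suc (length-run (suc st) l)

run-shift : ∀ d st l → map (d +_) (run st l) ≡ run (d + st) l
run-shift d st zero = refl
run-shift d st (suc l) = cong (d + st ∷_) (trans (run-shift d (suc st) l) (cong (λ z → run z l) (+-suc d st)))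

run-++ : ∀ st l₁ l₂ → run st (l₁ + l₂) ≡ run st l₁ ++ run (st + l₁) l₂
run-++ st zero l₂ = cong (λ z → run z l₂) (sym (+-identityʳ st))
run-++ st (suc l₁) l₂ =
  cong (st ∷_) (trans (run-++ (suc st) l₁ l₂) (cong (λ z → run (suc st) l₁ ++ run z l₂) (sym (+-suc st l₁))))

concatF-run : ∀ s c st → concatF s (λ r → run (toℕ r * c + st) c) ≡ run st (s * c)
concatF-run zero c st = refl
concatF-run (suc s) c st = begin
    run st c ++ concatF s (λ r → run (c + toℕ r * c + st) c)
      ≡⟨ cong (run st c ++_) (concatF-ext s (λ r → cong (λ z → run z c) (shift r))) ⟩
    run st c ++ concatF s (λ r → run (toℕ r * c + (st + c)) c)
      ≡⟨ cong (run st c ++_) (concatF-run s c (st + c)) ⟩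
    run st c ++ run (st + c) (s * c)
      ≡⟨ sym (run-++ st c (s * c)) ⟩
    run st (c + s * c) ∎
  where
  open ≡-Reasoning
  shift : ∀ (r : Fin s) → c + toℕ r * c + st ≡ toℕ r * c + (st + c)
  shift r = solve 3 (λ c x o → c :+ x :+ o := x :+ (o :+ c)) refl c (toℕ r * c) st

run-bounded : ∀ st l → All (λ q → q < st + l) (run st l)
run-bounded st zero = []
run-bounded st (suc l) =
  ≤-trans (s≤s (m≤m+n st l)) (≤-reflexive (sym (+-suc st l))) ∷
  All.map (λ q<· → ≤-trans q<· (≤-reflexive (sym (+-suc st l)))) (run-bounded (suc st) l)

-- Jobs y : J have a release time ρ y and
-- a deadline δ y; a job may occupy slot p iff ρ y ≤ p < δ y.  If, from time t
-- on, no interval [a , b) has more jobs confined to it than slots (Hall's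
-- condition), then the k jobs can be placed bijectively into the slots
-- t , … , t+k−1: always run a released job with the earliest deadline.
module EDF {J : Set} (ρ δ : J → ℕ) where

  -- Seen at time t, job y has to be run inside the slots [a , b).
  confined : ℕ → ℕ → ℕ → J → Bool
  confined t a b y = ((a ≤ᵇ t) ∨ (a ≤ᵇ ρ y)) ∧ (δ y ≤ᵇ b)

  confined-intro : ∀ t a b {y} → a ≤ t ⊎ a ≤ ρ y → δ y ≤ b → T (confined t a b y)
  confined-intro t a b (inj₁ a≤t) δ≤b = from T-∧ (from T-∨ (inj₁ (≤⇒≤ᵇ a≤t)) , ≤⇒≤ᵇ δ≤b)
  confined-intro t a b (inj₂ a≤ρ) δ≤b = from T-∧ (from T-∨ (inj₂ (≤⇒≤ᵇ a≤ρ)) , ≤⇒≤ᵇ δ≤b)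

  confined-elim : ∀ t a b {y} → T (confined t a b y) → (a ≤ t ⊎ a ≤ ρ y) × δ y ≤ b
  confined-elim t a b {y} h with to T-∧ h
  ... | h₁ , h₂ with to T-∨ h₁
  ...   | inj₁ a≤t = inj₁ (≤ᵇ⇒≤ a t a≤t) , ≤ᵇ⇒≤ (δ y) b h₂
  ...   | inj₂ a≤ρ = inj₂ (≤ᵇ⇒≤ a (ρ y) a≤ρ) , ≤ᵇ⇒≤ (δ y) b h₂

  Hall : ℕ → List J → Set
  Hall t js = ∀ a b → t ≤ a → a ≤ b → countL (confined t a b) js ≤ b ∸ a

  record Urgent (t : ℕ) (js : List J) : Set where
    constructor mkUrgent
    field
      pre      : List J
      x        : J
      post     : List J
      split    : js ≡ pre ++ x ∷ post
      released : ρ x ≤ t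
      earliest : All (λ y → ρ y ≤ t → δ x ≤ δ y) (pre ++ post)

  urgent? : ∀ t js → Urgent t js ⊎ All (λ y → t < ρ y) js
  urgent? t [] = inj₂ []
  urgent? t (y ∷ ys) with urgent? t ys | ρ y ≤? t
  ... | inj₂ none | yes ρy≤t = inj₁ (mkUrgent [] y ys refl ρy≤t (All.map (λ t<ρ ρ≤t → ⊥-elim (<⇒≱ t<ρ ρ≤t)) none))
  ... | inj₂ none | no ρy≰t  = inj₂ (≰⇒> ρy≰t ∷ none)
  ... | inj₁ (mkUrgent pre x post refl rel ear) | no ρy≰t =
        inj₁ (mkUrgent (y ∷ pre) x post refl rel ((λ ρy≤t → ⊥-elim (ρy≰t ρy≤t)) ∷ ear))
  ... | inj₁ (mkUrgent pre x post refl rel ear) | yes ρy≤t with δ y ≤? δ x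
  ...   | yes δy≤δx = inj₁ (mkUrgent [] y (pre ++ x ∷ post) refl ρy≤t
            (let (ear₁ , ear₂) = ++⁻ pre ear
                 via-x = All.map (λ f ρ≤t → ≤-trans δy≤δx (f ρ≤t))
             in ++⁺ (via-x ear₁) ((λ _ → δy≤δx) ∷ via-x ear₂)))
  ...   | no δy≰δx = inj₁ (mkUrgent (y ∷ pre) x post refl rel ((λ _ → <⇒≤ (≰⇒> δy≰δx)) ∷ ear))

  some-released : ∀ {k t js} → length js ≡ suc k → Hall t js → All (λ y → δ y ≤ t + suc k) js →
                  All (λ y → t < ρ y) js → ⊥
  some-released {k} {t} {js} len hall due none = 1+n≰n (begin
      suc k                                      ≡⟨ sym (trans (countL-all all-confined) len) ⟩
      countL (confined t (suc t) (t + suc k)) js ≤⟨ hall (suc t) (t + suc k) (n≤1+n t) t<t+suc-k ⟩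
      t + suc k ∸ suc t                          ≡⟨ trans (cong (_∸ suc t) (+-suc t k)) (m+n∸m≡n t k) ⟩
      k                                          ∎)
    where
    open ≤-Reasoning
    t<t+suc-k : suc t ≤ t + suc k
    t<t+suc-k = ≤-trans (s≤s (m≤m+n t k)) (≤-reflexive (sym (+-suc t k)))
    all-confined : All (λ y → T (confined t (suc t) (t + suc k) y)) js
    all-confined = All.zipWith (λ (t<ρ , δ≤) → confined-intro t (suc t) (t + suc k) (inj₂ t<ρ) δ≤) (none , due)

  after-now : ∀ {t} pre x post → Hall t (pre ++ x ∷ post) → t < δ x
  after-now {t} pre x post hall with δ x ≤? t
  ... | no δx≰t = ≰⇒> δx≰t
  ... | yes δx≤t = ⊥-elim (1+n≰n (begin
      1                                           ≤⟨ m≤m+n 1 _ ⟩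
      1 + countL (confined t t t) (pre ++ post)   ≡⟨ cong (_+ _) (cong bit (T⇒≡true x-confined)) ⟨
      bit (confined t t t x) + countL (confined t t t) (pre ++ post)
                                                  ≡⟨ countL-remove (confined t t t) pre x post ⟨
      countL (confined t t t) (pre ++ x ∷ post)   ≤⟨ hall t t ≤-refl ≤-refl ⟩
      t ∸ t                                       ≡⟨ n∸n≡0 t ⟩
      0                                           ∎))
    where
    open ≤-Reasoning
    x-confined : T (confined t t t x)
    x-confined = confined-intro t t t (inj₁ ≤-refl) δx≤t

  -- Jobs confined to [a , b) at time t+1 which cannot start before a were
  -- already confined to [a , b) at time t, and removing x only lowers counts.
  hall-late : ∀ {t} pre x post → Hall t (pre ++ x ∷ post) → ∀ a b → t ≤ a → a ≤ b →
    All (λ y → T (confined (suc t) a b y) → a ≤ ρ y) (pre ++ post) →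
    countL (confined (suc t) a b) (pre ++ post) ≤ b ∸ a
  hall-late {t} pre x post hall a b t≤a a≤b late = begin
      countL (confined (suc t) a b) (pre ++ post)   ≤⟨ countL-mono (All.map still late) ⟩
      countL (confined t a b) (pre ++ post)         ≤⟨ countL-remove-≤ _ pre x post ⟩
      countL (confined t a b) (pre ++ x ∷ post)     ≤⟨ hall a b t≤a a≤b ⟩
      b ∸ a                                         ∎
    where
    open ≤-Reasoning
    still : ∀ {y} → (T (confined (suc t) a b y) → a ≤ ρ y) → T (confined (suc t) a b y) → T (confined t a b y)
    still f h = confined-intro t a b (inj₂ (f h)) (proj₂ (confined-elim (suc t) a b h))

  hall-step : ∀ {t} pre x post → Hall t (pre ++ x ∷ post) →
              All (λ y → ρ y ≤ t → δ x ≤ δ y) (pre ++ post) → Hall (suc t) (pre ++ post)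
  hall-step {t} pre x post hall ear a b st≤a a≤b with m≤n⇒m<n∨m≡n st≤a
  ... | inj₁ st<a = hall-late pre x post hall a b (≤-trans (n≤1+n t) st≤a) a≤b
          (All.tabulate (λ {y} _ h → case-late y (proj₁ (confined-elim (suc t) a b h))))
    where
    case-late : ∀ y → a ≤ suc t ⊎ a ≤ ρ y → a ≤ ρ y
    case-late y (inj₁ a≤st) = ⊥-elim (<⇒≱ st<a a≤st)
    case-late y (inj₂ a≤ρ)  = a≤ρ
  ... | inj₂ refl with δ x ≤? b
  ...   | no δx≰b = hall-late pre x post hall (suc t) b (n≤1+n t) a≤b (All.map not-released ear)
    where
    not-released : ∀ {y} → (ρ y ≤ t → δ x ≤ δ y) → T (confined (suc t) (suc t) b y) → suc t ≤ ρ y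
    not-released {y} f h with ρ y ≤? t
    ... | no ρy≰t = ≰⇒> ρy≰t
    ... | yes ρy≤t = ⊥-elim (δx≰b (≤-trans (f ρy≤t) (proj₂ (confined-elim (suc t) (suc t) b h))))
  ...   | yes δx≤b = subst (countL (confined (suc t) (suc t) b) (pre ++ post) ≤_) (pred[m∸n]≡m∸[1+n] b t) (suc[m]≤n⇒m≤pred[n] (begin
      suc (countL (confined (suc t) (suc t) b) (pre ++ post)) ≤⟨ s≤s (countL-mono {xs = pre ++ post} (All.tabulate (λ _ → due-by-b))) ⟩
      suc (countL (confined t t b) (pre ++ post))           ≡⟨ cong (_+ _) (cong bit (T⇒≡true x-confined)) ⟨
      bit (confined t t b x) + countL (confined t t b) (pre ++ post)
                                                            ≡⟨ countL-remove (confined t t b) pre x post ⟨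
      countL (confined t t b) (pre ++ x ∷ post)             ≤⟨ hall t b ≤-refl (≤-trans (n≤1+n t) a≤b) ⟩
      b ∸ t                                                 ∎))
    where
    open ≤-Reasoning
    x-confined : T (confined t t b x)
    x-confined = confined-intro t t b (inj₁ ≤-refl) δx≤b
    due-by-b : ∀ {y} → T (confined (suc t) (suc t) b y) → T (confined t t b y)
    due-by-b {y} h = confined-intro t t b (inj₁ ≤-refl) (proj₂ (confined-elim (suc t) (suc t) b h))

  -- A schedule of the jobs js in the slots t , … , t+k−1: slot q runs job q
  -- within its window, and 'job' lists js with multiplicities.
  record Schedule (t k : ℕ) (js : List J) : Set where
    field
      job      : Fin k → J
      inWindow : ∀ q → ρ (job q) ≤ t + toℕ q × t + toℕ q < δ (job q)
      lists    : ∀ p → count k (λ q → p (job q)) ≡ countL p js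

  edf : ∀ k t js → length js ≡ k → Hall t js → All (λ y → δ y ≤ t + k) js → Schedule t k js
  edf zero t [] _ _ _ = record { job = λ () ; inWindow = λ () ; lists = λ p → refl }
  edf (suc k) t js len hall due with urgent? t js
  ... | inj₂ none = ⊥-elim (some-released len hall due none)
  ... | inj₁ (mkUrgent pre x post refl released earliest) =
        record { job = job ; inWindow = inWindow ; lists = lists }
    where
    length-rest : length (pre ++ post) ≡ k
    length-rest = suc-injective (begin
      suc (length (pre ++ post))  ≡⟨ cong suc (length-++ pre) ⟩
      suc (length pre + length post) ≡⟨ +-suc (length pre) (length post) ⟨
      length pre + length (x ∷ post) ≡⟨ length-++ pre ⟨
      length (pre ++ x ∷ post)    ≡⟨ len ⟩
      suc k                       ∎)
      where open ≡-Reasoning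
    due-rest : All (λ y → δ y ≤ suc t + k) (pre ++ post)
    due-rest = let (due₁ , due₂) = ++⁻ pre due
                   shift = All.map (λ δ≤ → ≤-trans δ≤ (≤-reflexive (+-suc t k)))
               in ++⁺ (shift due₁) (shift (All.tail due₂))
    rest : Schedule (suc t) k (pre ++ post)
    rest = edf k (suc t) (pre ++ post) length-rest (hall-step pre x post hall earliest) due-rest
    open Schedule rest using () renaming (job to job′; inWindow to inWindow′; lists to lists′)
    job : Fin (suc k) → J
    job zero    = x
    job (suc q) = job′ q
    inWindow : ∀ q → ρ (job q) ≤ t + toℕ q × t + toℕ q < δ (job q)
    inWindow zero = ≤-trans released (≤-reflexive (sym (+-identityʳ t))) ,
                    ≤-trans (≤-reflexive (cong suc (+-identityʳ t))) (after-now pre x post hall)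
    inWindow (suc q) = let (r≤ , <δ) = inWindow′ q in
      ≤-trans r≤ (≤-reflexive (sym (+-suc t (toℕ q)))) , ≤-trans (≤-reflexive (cong suc (+-suc t (toℕ q)))) <δ
    lists : ∀ p → count (suc k) (λ q → p (job q)) ≡ countL p (pre ++ x ∷ post)
    lists p = trans (count-suc k (λ q → p (job q)))
                    (trans (cong (bit (p x) +_) (lists′ p)) (sym (countL-remove p pre x post)))

  scheduled-all : ∀ {t k js} (S : Schedule t k js) (p : J → Bool) → All (λ y → T (p y)) js →
                  ∀ q → T (p (Schedule.job S q))
  scheduled-all {k = k} S p all-p q = not≡false⇒T (count≡0⇒false k none q)
    where
    none : count k (λ q → not (p (Schedule.job S q))) ≡ 0
    none = trans (Schedule.lists S (λ y → not (p y))) (countL-none (All.map (λ py → cong not (T⇒≡true py)) all-p))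
    not≡false⇒T : ∀ {b} → not b ≡ false → T b
    not≡false⇒T {true} _ = tt

module IntegerParts where
  open import Data.Integer using (+_)
  open ℤSolver.+-*-Solver using () renaming (solve to solveℤ; _:=_ to _:=ℤ_; _:+_ to _:+ℤ_; _:*_ to _:*ℤ_; :-_ to :-ℤ_; con to conℤ)

  _⁺ _⁻ : ℤ → ℕ
  (+ k) ⁺    = k
  -[1+ k ] ⁺ = 0
  (+ k) ⁻    = 0
  -[1+ k ] ⁻ = suc k

  ⁺-positive : ∀ z → 0 < z ⁺ → + 0 <ℤ z
  ⁺-positive (+ suc k) _ = ℤ.+<+ (s≤s z≤n)

  ⁻-negative : ∀ z → 0 < z ⁻ → z <ℤ + 0
  ⁻-negative -[1+ k ] _ = ℤ.-<+

  ∣∣-parts : ∀ z → (z ⁻ ≡ 0 × ∣ z ∣ ≡ z ⁺) ⊎ (z ⁺ ≡ 0 × ∣ z ∣ ≡ z ⁻)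
  ∣∣-parts (+ k)    = inj₁ (refl , refl)
  ∣∣-parts -[1+ k ] = inj₂ (refl , refl)

  parts-* : ∀ z x → z *ℤ + x +ℤ + (z ⁻ * x) ≡ + (z ⁺ * x)
  parts-* (+ k) x = trans (cong (_+ℤ + 0) (sym (ℤP.pos-* k x))) (ℤP.+-identityʳ _)
  parts-* -[1+ k ] x = trans (cong (λ w → (- (+ suc k)) *ℤ + x +ℤ w) (ℤP.pos-* (suc k) x))
    (solveℤ 2 (λ a b → (:-ℤ a) :*ℤ b :+ℤ a :*ℤ b :=ℤ conℤ (+ 0)) refl (+ suc k) (+ x))

  sumℤ-parts : ∀ k (h : Fin k → ℤ) (f g : Fin k → ℕ) → (∀ i → h i +ℤ + g i ≡ + f i) →
               sumℤ k h +ℤ + sumF k g ≡ + sumF k f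
  sumℤ-parts zero h f g e = refl
  sumℤ-parts (suc k) h f g e = begin
      (h zero +ℤ H) +ℤ + (g zero + sumF k (λ i → g (suc i)))
        ≡⟨ cong ((h zero +ℤ H) +ℤ_) (ℤP.pos-+ (g zero) _) ⟩
      (h zero +ℤ H) +ℤ (+ g zero +ℤ + sumF k (λ i → g (suc i)))
        ≡⟨ solveℤ 4 (λ a b c d → (a :+ℤ b) :+ℤ (c :+ℤ d) :=ℤ (a :+ℤ c) :+ℤ (b :+ℤ d)) refl (h zero) H (+ g zero) _ ⟩
      (h zero +ℤ + g zero) +ℤ (H +ℤ + sumF k (λ i → g (suc i)))
        ≡⟨ cong₂ _+ℤ_ (e zero) (sumℤ-parts k (λ i → h (suc i)) (λ i → f (suc i)) (λ i → g (suc i)) (λ i → e (suc i))) ⟩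
      + f zero +ℤ + sumF k (λ i → f (suc i))
        ≡⟨ ℤP.pos-+ (f zero) _ ⟨
      + (f zero + sumF k (λ i → f (suc i))) ∎
    where
    open ≡-Reasoning
    H = sumℤ k (λ i → h (suc i))

  balance : ∀ k (a : Fin k → ℤ) (x : Fin k → ℕ) → sumℤ k (λ i → a i *ℤ + x i) ≡ + 0 →
            sumF k (λ i → a i ⁻ * x i) ≡ sumF k (λ i → a i ⁺ * x i)
  balance k a x zero-sum = ℤP.+-injective (begin
      + sumF k (λ i → a i ⁻ * x i)                                 ≡⟨ ℤP.+-identityˡ _ ⟨
      + 0 +ℤ + sumF k (λ i → a i ⁻ * x i)                          ≡⟨ cong (_+ℤ + sumF k (λ i → a i ⁻ * x i)) zero-sum ⟨
      sumℤ k (λ i → a i *ℤ + x i) +ℤ + sumF k (λ i → a i ⁻ * x i)  ≡⟨ sumℤ-parts k _ _ _ (λ i → parts-* (a i) (x i)) ⟩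
      + sumF k (λ i → a i ⁺ * x i)                                 ∎)
    where open ≡-Reasoning

open IntegerParts

-- Floor division, with the convention x div 0 = 0.
_div_ : ℕ → ℕ → ℕ
x div zero  = 0
x div suc d = x / suc d

div-lower : ∀ x d {p} → p ≤ x div suc d → p * suc d ≤ x
div-lower x d {p} p≤ = ≤-trans (*-monoˡ-≤ (suc d) p≤) (m/n*n≤m x (suc d))

div-upper : ∀ x d {b} → x div suc d < b → x < b * suc d
div-upper x d {suc b} <b = begin-strict
    x                                ≡⟨ m≡m%n+[m/n]*n x (suc d) ⟩
    x % suc d + (x / suc d) * suc d  <⟨ +-monoˡ-< _ (m%n<n x (suc d)) ⟩
    suc d + (x / suc d) * suc d      ≤⟨ +-monoʳ-≤ (suc d) (*-monoˡ-≤ (suc d) (s≤s⁻¹ <b)) ⟩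
    suc d + b * suc d                ∎
  where open ≤-Reasoning

-- The cell of rank κ among R equal cells may use
-- slot p iff κ/R ≤ p/P ≤ (κ+1)/R; as a window [release , deadline) this is
-- release = ⌈κP/R⌉ and deadline = min(P , ⌊(κ+1)P/R⌋ + 1).
module Windows (P : ℕ) where

  release : ℕ → ℕ → ℕ
  release κ R = (κ * P + (R ∸ 1)) div R

  deadline : ℕ → ℕ → ℕ
  deadline κ R = P ⊓ suc ((suc κ * P) div R)

  window-sound : ∀ κ R p → κ < R → release κ R ≤ p → p < deadline κ R →
                 κ * P ≤ p * R × p * R ≤ suc κ * P
  window-sound κ (suc d) p _ rel≤p p<dl = lower , upper
    where
    open ≤-Reasoning
    lower : κ * P ≤ p * suc d
    lower = +-cancelʳ-≤ (suc d) _ _ (begin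
      κ * P + suc d        ≡⟨ +-suc (κ * P) d ⟩
      suc (κ * P + d)      ≤⟨ div-upper (κ * P + d) d (s≤s rel≤p) ⟩
      suc d + p * suc d    ≡⟨ +-comm (suc d) (p * suc d) ⟩
      p * suc d + suc d    ∎)
    upper : p * suc d ≤ suc κ * P
    upper = div-lower (suc κ * P) d (s≤s⁻¹ (≤-trans p<dl (m⊓n≤n P _)))

  -- Conversely, if the window lies inside [a , b), then so does κ/R … (κ+1)/R
  -- after scaling: a R < κ P + R and (κ+1) P ≤ b R.
  fits : ℕ → ℕ → ℕ → ℕ → Bool
  fits a b R κ = (a * R <ᵇ κ * P + R) ∧ (suc κ * P ≤ᵇ b * R)

  window-tight : ∀ κ R a b → κ < R → a ≤ release κ R → deadline κ R ≤ b → T (fits a b R κ)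
  window-tight κ (suc d) a b κ<R a≤rel dl≤b = from T-∧ (<⇒<ᵇ lower , ≤⇒≤ᵇ upper)
    where
    lower : a * suc d < κ * P + suc d
    lower = ≤-trans (s≤s (div-lower (κ * P + d) d a≤rel)) (≤-reflexive (sym (+-suc (κ * P) d)))
    upper : suc κ * P ≤ b * suc d
    upper with ≤-total P (suc ((suc κ * P) div suc d))
    ... | inj₁ P≤ = begin
      suc κ * P  ≤⟨ *-monoˡ-≤ P κ<R ⟩
      suc d * P  ≡⟨ *-comm (suc d) P ⟩
      P * suc d  ≤⟨ *-monoˡ-≤ (suc d) (≤-trans (≤-reflexive (sym (m≤n⇒m⊓n≡m P≤))) dl≤b) ⟩
      b * suc d  ∎
      where open ≤-Reasoning
    ... | inj₂ ≥P = <⇒≤ (div-upper (suc κ * P) d (≤-trans (≤-reflexive (sym (m≥n⇒m⊓n≡n ≥P))) dl≤b))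

  -- If C ranks in st , … , st+l−1 fit [a , b), the first of them, κ, satisfies
  -- C P + κ P ≤ b R (the fitting ranks are consecutive and the last one fits).
  first-fitting : ∀ a b R st l → countL (fits a b R) (run st l) ≡ 0 ⊎
    Σ ℕ (λ κ → st ≤ κ × T (fits a b R κ) × countL (fits a b R) (run st l) * P + κ * P ≤ b * R)
  first-fitting a b R st zero = inj₁ refl
  first-fitting a b R st (suc l) with fits a b R st in fit | first-fitting a b R (suc st) l
  ... | false | inj₁ none = inj₁ none
  ... | false | inj₂ (κ , st<κ , fκ , bound) = inj₂ (κ , ≤-trans (n≤1+n st) st<κ , fκ , bound)
  ... | true  | inj₁ none = inj₂ (st , ≤-refl , fits-st , (begin
      suc C * P + st * P  ≡⟨ cong (λ C → suc C * P + st * P) none ⟩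
      suc 0 * P + st * P  ≡⟨ cong (_+ st * P) (+-identityʳ P) ⟩
      suc st * P          ≤⟨ ≤ᵇ⇒≤ _ _ (proj₂ (to T-∧ fits-st)) ⟩
      b * R               ∎))
    where
    open ≤-Reasoning
    C = countL (fits a b R) (run (suc st) l)
    fits-st : T (fits a b R st)
    fits-st = subst T (sym fit) tt
  ... | true  | inj₂ (κ , st<κ , fκ , bound) = inj₂ (st , ≤-refl , subst T (sym fit) tt , (begin
      suc C * P + st * P  ≡⟨ solve 3 (λ C p s → (con 1 :+ C) :* p :+ s :* p := C :* p :+ (con 1 :+ s) :* p) refl C P st ⟩
      C * P + suc st * P  ≤⟨ +-monoʳ-≤ (C * P) (*-monoˡ-≤ P st<κ) ⟩
      C * P + κ * P       ≤⟨ bound ⟩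
      b * R               ∎))
    where
    open ≤-Reasoning
    C = countL (fits a b R) (run (suc st) l)

  -- Hence C ranks fitting [a , b) occupy at most (b − a) R / P units: C P + a R < b R + R.
  fitting-bound : ∀ a b R st l → let C = countL (fits a b R) (run st l) in
                  C ≡ 0 ⊎ C * P + a * R < b * R + R
  fitting-bound a b R st l with first-fitting a b R st l
  ... | inj₁ none = inj₁ none
  ... | inj₂ (κ , _ , fκ , bound) = inj₂ (begin-strict
      C * P + a * R        <⟨ +-monoʳ-< (C * P) (<ᵇ⇒< _ _ (proj₁ (to T-∧ fκ))) ⟩
      C * P + (κ * P + R)  ≡⟨ +-assoc (C * P) (κ * P) R ⟨
      C * P + κ * P + R    ≤⟨ +-monoˡ-≤ R bound ⟩
      b * R + R            ∎)
    where
    open ≤-Reasoning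
    C = countL (fits a b R) (run st l)

-- The time t/D lies in the interval [r/s , (r+1)/s] of the r-th of s copies.
Within : ℕ → ℕ → ℕ → ℕ → Set
Within D t s r = r * D ≤ t * s × t * s ≤ suc r * D

within? : ℕ → ℕ → ℕ → ℕ → Bool
within? D t s r = (r * D ≤ᵇ t * s) ∧ (t * s ≤ᵇ suc r * D)

within-intro : ∀ D t s r → Within D t s r → T (within? D t s r)
within-intro D t s r (lower , upper) = from T-∧ (≤⇒≤ᵇ lower , ≤⇒≤ᵇ upper)

within-elim : ∀ D t s r → T (within? D t s r) → Within D t s r
within-elim D t s r h = let (lower , upper) = to T-∧ h in ≤ᵇ⇒≤ _ _ lower , ≤ᵇ⇒≤ _ _ upper

within-left : ∀ s r → Within s r s r
within-left s r = ≤-refl , *-monoˡ-≤ s (n≤1+n r)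

within-scale : ∀ K D t s r → Within D t s r → Within (K * D) (t * K) s r
within-scale K D t s r (lower , upper) =
    ≤-trans (≤-reflexive (reorder r)) (≤-trans (*-monoʳ-≤ K lower) (≤-reflexive (regroup t)))
  , ≤-trans (≤-reflexive (sym (regroup t))) (≤-trans (*-monoʳ-≤ K upper) (≤-reflexive (sym (reorder (suc r)))))
  where
  reorder : ∀ x → x * (K * D) ≡ K * (x * D)
  reorder x = solve 3 (λ x k d → x :* (k :* d) := k :* (x :* d)) refl x K D
  regroup : ∀ x → K * (x * s) ≡ x * K * s
  regroup x = solve 3 (λ x k s → k :* (x :* s) := x :* k :* s) refl x K s

within-between : ∀ D s r {t₁ t₂ t₃} → t₁ ≤ t₂ → t₂ ≤ t₃ → Within D t₁ s r → Within D t₃ s r → Within D t₂ s r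
within-between D s r t₁≤t₂ t₂≤t₃ (lower , _) (_ , upper) =
  ≤-trans lower (*-monoˡ-≤ s t₁≤t₂) , ≤-trans (*-monoˡ-≤ s t₂≤t₃) upper

-- Coarsening a window: the e-th of the c sub-intervals of [r , r+1) lies in it,
-- i.e. the time t/P lies in the interval of the e-th part (e < c) of the r-th of
-- s intervals, split into c parts each, only if it lies in the r-th interval.
coarsen : ∀ c r e P t s → e < c → (r * c + e) * P ≤ t * s * c → t * s * c ≤ suc (r * c + e) * P →
          Within P t s r
coarsen c r e P t s e<c lower upper = *-cancelˡ-≤ c {{c≢0}} lower′ , *-cancelˡ-≤ c {{c≢0}} upper′
  where
  open ≤-Reasoning
  x = t * s
  c≢0 : NonZero c
  c≢0 = >-nonZero (≤-<-trans z≤n e<c)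
  lower′ : c * (r * P) ≤ c * x
  lower′ = begin
    c * (r * P)        ≡⟨ solve 3 (λ c r p → c :* (r :* p) := r :* c :* p) refl c r P ⟩
    r * c * P          ≤⟨ *-monoˡ-≤ P (m≤m+n (r * c) e) ⟩
    (r * c + e) * P    ≤⟨ lower ⟩
    x * c              ≡⟨ *-comm x c ⟩
    c * x              ∎
  upper′ : c * x ≤ c * (suc r * P)
  upper′ = begin
    c * x                  ≡⟨ *-comm c x ⟩
    x * c                  ≤⟨ upper ⟩
    suc (r * c + e) * P    ≤⟨ *-monoˡ-≤ P (≤-trans (≤-reflexive (sym (+-suc _ e))) (+-monoʳ-≤ (r * c) e<c)) ⟩
    (r * c + c) * P        ≡⟨ solve 3 (λ c r p → (r :* c :+ c) :* p := c :* ((con 1 :+ r) :* p)) refl c r P ⟩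
    c * (suc r * P)        ∎

-- Vertex (i , r), r < s i, owns c i cells, in total
-- P = Σ_i c_i s_i.  The cells are scheduled into the slots p < P so that the
-- owner (i , r) of slot p satisfies r/s_i ≤ p/P ≤ (r+1)/s_i.  Cell q of vertex
-- (i , r) has rank r c_i + q among the R_i = c_i s_i cells of class i and gets
-- the window of that rank.
module OneSide (k : ℕ) (s c : Fin k → ℕ) (P : ℕ) (total : sumF k (λ i → c i * s i) ≡ P) where
  open Windows P

  Vertex : Set
  Vertex = Σ (Fin k) (λ i → Fin (s i))

  Cell : Set
  Cell = Vertex × ℕ

  R : Fin k → ℕ
  R i = c i * s i

  cellsOf : Fin k → List Cell
  cellsOf i = concatF (s i) (λ r → map (λ q → ((i , r) , q)) (run 0 (c i)))

  cells : List Cell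
  cells = concatF k cellsOf

  classOf : Cell → Fin k
  classOf ((i , _) , _) = i

  rank : Cell → ℕ
  rank ((i , r) , q) = toℕ r * c i + q

  ρ δ : Cell → ℕ
  ρ cl = release (rank cl) (R (classOf cl))
  δ cl = deadline (rank cl) (R (classOf cl))

  wellFormed : Cell → Bool
  wellFormed cl = (proj₂ cl <ᵇ c (classOf cl)) ∧ (rank cl <ᵇ R (classOf cl))

  wellFormed-elim : ∀ cl → T (wellFormed cl) → proj₂ cl < c (classOf cl) × rank cl < R (classOf cl)
  wellFormed-elim cl h = let (h₁ , h₂) = to T-∧ h in <ᵇ⇒< _ _ h₁ , <ᵇ⇒< _ _ h₂

  rank<R : ∀ {i} (r : Fin (s i)) q → q < c i → toℕ r * c i + q < R i
  rank<R {i} r q q<c = begin-strict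
    toℕ r * c i + q    <⟨ +-monoʳ-< _ q<c ⟩
    toℕ r * c i + c i  ≡⟨ +-comm _ (c i) ⟩
    suc (toℕ r) * c i  ≤⟨ *-monoˡ-≤ (c i) (FP.toℕ<n r) ⟩
    s i * c i          ≡⟨ *-comm (s i) (c i) ⟩
    c i * s i          ∎
    where open ≤-Reasoning

  cellsOf-wf : ∀ i → All (λ cl → classOf cl ≡ i × T (wellFormed cl)) (cellsOf i)
  cellsOf-wf i = All-concatF (s i) _ (λ r → map⁺ (All.map (λ {q} q<c →
                   refl , from T-∧ (<⇒<ᵇ q<c , <⇒<ᵇ (rank<R r q q<c))) (run-bounded 0 (c i))))

  rank-cellsOf : ∀ i → map rank (cellsOf i) ≡ run 0 (R i)
  rank-cellsOf i = begin
    map rank (cellsOf i)                                     ≡⟨ map-concatF rank (s i) _ ⟩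
    concatF (s i) (λ r → map rank (map (λ q → ((i , r) , q)) (run 0 (c i))))
                                                             ≡⟨ concatF-ext (s i) (λ r → sym (map-∘ (run 0 (c i)))) ⟩
    concatF (s i) (λ r → map (toℕ r * c i +_) (run 0 (c i))) ≡⟨ concatF-ext (s i) (λ r → run-shift (toℕ r * c i) 0 (c i)) ⟩
    concatF (s i) (λ r → run (toℕ r * c i + 0) (c i))        ≡⟨ concatF-run (s i) (c i) 0 ⟩
    run 0 (s i * c i)                                        ≡⟨ cong (run 0) (*-comm (s i) (c i)) ⟩
    run 0 (R i)                                              ∎
    where open ≡-Reasoning

  length-cells : length cells ≡ P
  length-cells = begin
    length cells                                     ≡⟨ length-concatF k cellsOf ⟩
    sumF k (λ i → length (cellsOf i))                ≡⟨ sumF-ext k (λ i → sym (length-map rank (cellsOf i))) ⟩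
    sumF k (λ i → length (map rank (cellsOf i)))     ≡⟨ sumF-ext k (λ i → cong length (rank-cellsOf i)) ⟩
    sumF k (λ i → length (run 0 (R i)))              ≡⟨ sumF-ext k (λ i → length-run 0 (R i)) ⟩
    sumF k R                                         ≡⟨ total ⟩
    P                                                ∎
    where open ≡-Reasoning

  open EDF ρ δ

  fitting : ℕ → ℕ → Fin k → ℕ
  fitting a b i = countL (fits a b (R i)) (run 0 (R i))

  class-confined : ∀ a b i → countL (confined 0 a b) (cellsOf i) ≤ fitting a b i
  class-confined a b i = begin
    countL (confined 0 a b) (cellsOf i)                   ≤⟨ countL-mono {xs = cellsOf i} (All.map (λ {cl} → rank-fits cl) (cellsOf-wf i)) ⟩
    countL (λ cl → fits a b (R i) (rank cl)) (cellsOf i)  ≡⟨ countL-map (fits a b (R i)) rank (cellsOf i) ⟨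
    countL (fits a b (R i)) (map rank (cellsOf i))        ≡⟨ cong (countL _) (rank-cellsOf i) ⟩
    fitting a b i                                         ∎
    where
    open ≤-Reasoning
    rank-fits : ∀ cl → classOf cl ≡ i × T (wellFormed cl) → T (confined 0 a b cl) → T (fits a b (R i) (rank cl))
    rank-fits cl (refl , wf) h with confined-elim 0 a b {cl} h
    ... | inj₁ a≤0 , dl≤b = window-tight (rank cl) (R i) a b (proj₂ (wellFormed-elim cl wf)) (≤-trans a≤0 z≤n) dl≤b
    ... | inj₂ a≤ρ , dl≤b = window-tight (rank cl) (R i) a b (proj₂ (wellFormed-elim cl wf)) a≤ρ dl≤b

  load room : ℕ → ℕ → Fin k → ℕ
  load a b i = fitting a b i * P + a * R i
  room a b i = b * R i + R i

  class-fitting : ∀ a b → a ≤ b → ∀ i → (fitting a b i ≡ 0 × load a b i ≤ room a b i) ⊎ load a b i < room a b i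
  class-fitting a b a≤b i with fitting-bound a b (R i) 0 (R i)
  ... | inj₂ X<Y = inj₂ X<Y
  ... | inj₁ none = inj₁ (none , (begin
    fitting a b i * P + a * R i  ≡⟨ cong (λ C → C * P + a * R i) none ⟩
    a * R i                      ≤⟨ *-monoˡ-≤ (R i) a≤b ⟩
    b * R i                      ≤⟨ m≤m+n (b * R i) (R i) ⟩
    b * R i + R i                ∎))
    where open ≤-Reasoning

  -- Summed over the classes (Σ R_i = P), at most b − a ranks fit [a , b).
  total-fitting : ∀ a b → a ≤ b → sumF k (fitting a b) ≤ b ∸ a
  total-fitting a b a≤b with sumF-strict k (load a b) (room a b) (fitting a b) (class-fitting a b a≤b)
  ... | inj₁ none = ≤-trans (≤-reflexive none) z≤n
  ... | inj₂ X<Y = m+n≤o⇒m≤o∸n C (s≤s⁻¹ (*-cancelʳ-< P (C + a) (suc b) (begin-strict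
      (C + a) * P                      ≡⟨ *-distribʳ-+ P C a ⟩
      C * P + a * P                    ≡⟨ sum-load ⟨
      sumF k (load a b)                <⟨ X<Y ⟩
      sumF k (room a b)                ≡⟨ sum-room ⟩
      suc b * P                        ∎)))
    where
    open ≤-Reasoning
    C = sumF k (fitting a b)
    sum-load : sumF k (load a b) ≡ C * P + a * P
    sum-load = trans (sumF-+ k _ _) (cong₂ _+_
              (trans (sumF-ext k (λ i → *-comm (fitting a b i) P)) (trans (sumF-*ˡ k P (fitting a b)) (*-comm P C)))
              (trans (sumF-*ˡ k a R) (cong (a *_) total)))
    sum-room : sumF k (room a b) ≡ suc b * P
    sum-room = trans (sumF-+ k _ _) (trans (cong₂ _+_ (trans (sumF-*ˡ k b R) (cong (b *_) total)) total) (+-comm (b * P) P))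

  hall : Hall 0 cells
  hall a b _ a≤b = begin
    countL (confined 0 a b) cells                       ≡⟨ countL-concatF _ k cellsOf ⟩
    sumF k (λ i → countL (confined 0 a b) (cellsOf i))  ≤⟨ sumF-mono k (class-confined a b) ⟩
    sumF k (fitting a b)                                ≤⟨ total-fitting a b a≤b ⟩
    b ∸ a                                               ∎
    where open ≤-Reasoning

  -- Kept abstract: only its specification matters, and unfolding the
  -- scheduler during type checking is prohibitively expensive.
  abstract
    schedule : Schedule 0 P cells
    schedule = edf P 0 cells length-cells hall (All.tabulate (λ _ → m⊓n≤m P _))

  open Schedule schedule using (job; inWindow; lists)

  owner : Fin P → Vertex
  owner q = proj₁ (job q)

  job-wf : ∀ q → proj₂ (job q) < c (classOf (job q)) × rank (job q) < R (classOf (job q))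
  job-wf q = wellFormed-elim (job q)
    (scheduled-all schedule wellFormed (All-concatF k cellsOf (λ i → All.map proj₂ (cellsOf-wf i))) q)

  owner-positive : ∀ q → 0 < c (proj₁ (owner q))
  owner-positive q = ≤-<-trans z≤n (proj₁ (job-wf q))

  owner-contains : ∀ q → Within P (toℕ q) (s (proj₁ (owner q))) (toℕ (proj₂ (owner q)))
  owner-contains q = contains (job q) (inWindow q) (job-wf q)
    where
    contains : ∀ cl → ρ cl ≤ 0 + toℕ q × 0 + toℕ q < δ cl → proj₂ cl < c (classOf cl) × rank cl < R (classOf cl) →
               Within P (toℕ q) (s (classOf cl)) (toℕ (proj₂ (proj₁ cl)))
    contains ((i , r) , e) (rel≤q , q<dl) (e<c , rank<R) with window-sound (toℕ r * c i + e) (R i) (toℕ q) rank<R rel≤q q<dl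
    ... | lower , upper = coarsen (c i) (toℕ r) e P (toℕ q) (s i) e<c
                            (≤-trans lower (≤-reflexive (regroup (toℕ q))))
                            (≤-trans (≤-reflexive (sym (regroup (toℕ q)))) upper)
      where
      regroup : ∀ x → x * (c i * s i) ≡ x * s i * c i
      regroup x = solve 3 (λ x c s → x :* (c :* s) := x :* s :* c) refl x (c i) (s i)

  owner-count : ∀ (pr : Vertex → Bool) →
    count P (λ q → pr (owner q)) ≡ sumF k (λ i → sumF (s i) (λ r → bit (pr (i , r)) * c i))
  owner-count pr = begin
    count P (λ q → pr (owner q))                       ≡⟨ lists (λ cl → pr (proj₁ cl)) ⟩
    countL (λ cl → pr (proj₁ cl)) cells                ≡⟨ countL-concatF _ k cellsOf ⟩
    sumF k (λ i → countL (λ cl → pr (proj₁ cl)) (cellsOf i))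
                                                       ≡⟨ sumF-ext k (λ i → countL-concatF _ (s i) _) ⟩
    sumF k (λ i → sumF (s i) (λ r → countL (λ cl → pr (proj₁ cl)) (map (λ q → ((i , r) , q)) (run 0 (c i)))))
                                                       ≡⟨ sumF-ext k (λ i → sumF-ext (s i) (λ r → per-vertex i r)) ⟩
    sumF k (λ i → sumF (s i) (λ r → bit (pr (i , r)) * c i)) ∎
    where
    open ≡-Reasoning
    per-vertex : ∀ i r → countL (λ cl → pr (proj₁ cl)) (map (λ q → ((i , r) , q)) (run 0 (c i))) ≡ bit (pr (i , r)) * c i
    per-vertex i r = trans (countL-map _ (λ q → ((i , r) , q)) (run 0 (c i)))
                    (trans (countL-const (pr (i , r)) (run 0 (c i))) (cong (bit (pr (i , r)) *_) (length-run 0 (c i))))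

module Construction (m n : ℕ) (A : Matrix m n) (b : Fin m → ℤ) (s : Fin n → ℕ) (sol : IsSolution A b s) where
  open import Data.Integer using (+_)

  -- Class 0 (the constant term) has exactly one vertex.
  s₀ : Fin (suc n) → ℕ
  s₀ zero    = 1
  s₀ (suc i) = s i

  a : Fin m → Fin (suc n) → ℤ
  a = ext A b

  row-sum : ∀ j → sumℤ (suc n) (λ i → a j i *ℤ + s₀ i) ≡ + 0
  row-sum j = trans (cong₂ _+ℤ_ (ℤP.*-identityʳ (- b j)) (sol j)) (ℤP.+-inverseˡ (b j))

  P : Fin m → ℕ
  P j = sumF (suc n) (λ i → a j i ⁺ * s₀ i)

  -- Both sides of constraint j have P j cells.
  -- (Abstract: only the equation is needed, and unfolding its proof is costly.)
  abstract
    neg-total : ∀ j → sumF (suc n) (λ i → a j i ⁻ * s₀ i) ≡ P j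
    neg-total j = balance (suc n) (a j) s₀ (row-sum j)

  module Pos (j : Fin m) = OneSide (suc n) s₀ (λ i → a j i ⁺) (P j) refl
  module Neg (j : Fin m) = OneSide (suc n) s₀ (λ i → a j i ⁻) (P j) (neg-total j)

  Vertex : Set
  Vertex = Σ (Fin (suc n)) (λ i → Fin (s₀ i))

  NV NE : ℕ
  NV = sumF (suc n) s₀
  NE = sumF m P

  vertex : Vertex → Fin NV
  vertex (i , r) = enc (suc n) s₀ i r

  vertexOf : Fin NV → Vertex
  vertexOf = dec (suc n) s₀

  vertexOf-vertex : ∀ w → vertexOf (vertex w) ≡ w
  vertexOf-vertex (i , r) = dec-enc (suc n) s₀ i r

  endpoints : Σ (Fin m) (λ j → Fin (P j)) → Fin NV × Fin NV
  endpoints (j , p) = vertex (Pos.owner j p) , vertex (Neg.owner j p)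

  G : LGraph n m
  G = record { N    = NV
             ; M    = NE
             ; vlab = λ v → proj₁ (vertexOf v)
             ; ends = λ x → endpoints (dec m P x)
             ; elab = λ x → proj₁ (dec m P x) }

  vertex-count : ∀ i → vcount G i ≡ s₀ i
  vertex-count i = begin
    count NV (λ v → ⌊ proj₁ (vertexOf v) F.≟ i ⌋)          ≡⟨ count-ext NV (λ v → sym (∧-identityʳ ⌊ proj₁ (vertexOf v) F.≟ i ⌋)) ⟩
    count NV (λ v → ⌊ proj₁ (vertexOf v) F.≟ i ⌋ ∧ true)   ≡⟨ count-fibre (suc n) s₀ i (λ _ → true) ⟩
    count (s₀ i) (λ _ → true)                               ≡⟨ count-all (s₀ i) (λ _ → refl) ⟩
    s₀ i                                                    ∎
    where open ≡-Reasoning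

  signs : ∀ j p → (+ 0 <ℤ a j (proj₁ (vertexOf (vertex (Pos.owner j p))))) ×
                  (a j (proj₁ (vertexOf (vertex (Neg.owner j p)))) <ℤ + 0)
  signs j p =
    subst (λ w → + 0 <ℤ a j (proj₁ w)) (sym (vertexOf-vertex (Pos.owner j p))) (⁺-positive _ (Pos.owner-positive j p)) ,
    subst (λ w → a j (proj₁ w) <ℤ + 0) (sym (vertexOf-vertex (Neg.owner j p))) (⁻-negative _ (Neg.owner-positive j p))

  module _ (c : Fin (suc n) → ℕ) (Q : ℕ) (total : sumF (suc n) (λ i → c i * s₀ i) ≡ Q) where
    open OneSide (suc n) s₀ c Q total using (owner; owner-count; owner-positive)

    hits : Vertex → Fin Q → Bool
    hits w p = ⌊ vertex (owner p) F.≟ vertex w ⌋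

    side-degree : ∀ w → count Q (hits w) ≡ c (proj₁ w)
    side-degree (i₀ , r₀) = trans (owner-count (λ w → ⌊ vertex w F.≟ vertex (i₀ , r₀) ⌋)) (sumF-point (suc n) s₀ c i₀ r₀)

    side-avoids : ∀ w → c (proj₁ w) ≡ 0 → ∀ p → hits w p ≡ false
    side-avoids w c≡0 p = ⌊≟⌋-≢ (λ same →
      <-irrefl (sym c≡0) (subst (λ i → 0 < c i) (enc-injective₁ (suc n) s₀ same) (owner-positive p)))

  -- Only the side carrying the sign of a_{j,i} meets w, giving degree ∣a_{j,i}∣.
  constraint-degree : ∀ j w →
    count (P j) (λ p → hits (λ i → a j i ⁺) (P j) refl w p ∨ hits (λ i → a j i ⁻) (P j) (neg-total j) w p)
      ≡ ∣ a j (proj₁ w) ∣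
  constraint-degree j w with ∣∣-parts (a j (proj₁ w))
  ... | inj₁ (⁻≡0 , ∣a∣≡⁺) = begin
      count (P j) (λ p → hits c⁺ (P j) refl w p ∨ hits c⁻ (P j) (neg-total j) w p)
        ≡⟨ count-ext (P j) (λ p → cong (hits c⁺ (P j) refl w p ∨_) (side-avoids c⁻ (P j) (neg-total j) w ⁻≡0 p)) ⟩
      count (P j) (λ p → hits c⁺ (P j) refl w p ∨ false)
        ≡⟨ count-ext (P j) (λ p → ∨-identityʳ _) ⟩
      count (P j) (hits c⁺ (P j) refl w)
        ≡⟨ side-degree c⁺ (P j) refl w ⟩
      a j (proj₁ w) ⁺
        ≡⟨ ∣a∣≡⁺ ⟨
      ∣ a j (proj₁ w) ∣ ∎
    where
    open ≡-Reasoning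
    c⁺ c⁻ : Fin (suc n) → ℕ
    c⁺ i = a j i ⁺
    c⁻ i = a j i ⁻
  ... | inj₂ (⁺≡0 , ∣a∣≡⁻) = begin
      count (P j) (λ p → hits c⁺ (P j) refl w p ∨ hits c⁻ (P j) (neg-total j) w p)
        ≡⟨ count-ext (P j) (λ p → cong (_∨ hits c⁻ (P j) (neg-total j) w p) (side-avoids c⁺ (P j) refl w ⁺≡0 p)) ⟩
      count (P j) (hits c⁻ (P j) (neg-total j) w)
        ≡⟨ side-degree c⁻ (P j) (neg-total j) w ⟩
      a j (proj₁ w) ⁻
        ≡⟨ ∣a∣≡⁻ ⟨
      ∣ a j (proj₁ w) ∣ ∎
    where
    open ≡-Reasoning
    c⁺ c⁻ : Fin (suc n) → ℕ
    c⁺ i = a j i ⁺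
    c⁻ i = a j i ⁻

  degree : ∀ j v → degIn G j v ≡ ∣ a j (proj₁ (vertexOf v)) ∣
  degree j v = begin
    degIn G j v
      ≡⟨ count-fibre m P j (λ e → ⌊ proj₁ (endpoints e) F.≟ v ⌋ ∨ ⌊ proj₂ (endpoints e) F.≟ v ⌋) ⟩
    count (P j) (λ p → ⌊ vertex (Pos.owner j p) F.≟ v ⌋ ∨ ⌊ vertex (Neg.owner j p) F.≟ v ⌋)
      ≡⟨ cong (λ u → count (P j) (λ p → ⌊ vertex (Pos.owner j p) F.≟ u ⌋ ∨ ⌊ vertex (Neg.owner j p) F.≟ u ⌋))
              (sym (enc-dec (suc n) s₀ v)) ⟩
    count (P j) (λ p → ⌊ vertex (Pos.owner j p) F.≟ vertex (vertexOf v) ⌋ ∨ ⌊ vertex (Neg.owner j p) F.≟ vertex (vertexOf v) ⌋)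
      ≡⟨ constraint-degree j (vertexOf v) ⟩
    ∣ a j (proj₁ (vertexOf v)) ∣ ∎
    where open ≡-Reasoning

  inClass : InClass A b G
  inClass = vertex-count zero , (λ x → inj₁ (signs (proj₁ (dec m P x)) (proj₂ (dec m P x)))) , degree

  solution : SolIs G s
  solution i = vertex-count (suc i)

-- A point meets at most two of the intervals [r D , (r+1) D]: r is ⌊x/D⌋ or ⌊x/D⌋ − 1.
count-index≤1 : ∀ k d → count k (λ r → toℕ r ≡ᵇ d) ≤ 1
count-index≤1 zero    d       = z≤n
count-index≤1 (suc k) zero    = ≤-reflexive (cong suc (count-none k (λ _ → refl)))
count-index≤1 (suc k) (suc d) = count-index≤1 k d

count-successor≤1 : ∀ k d → count k (λ r → suc (toℕ r) ≡ᵇ d) ≤ 1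
count-successor≤1 k zero    = ≤-trans (≤-reflexive (count-none k (λ _ → refl))) z≤n
count-successor≤1 k (suc d) = count-index≤1 k d

at-most-two : ∀ k D x → 0 < D → count k (λ r → (toℕ r * D ≤ᵇ x) ∧ (x ≤ᵇ suc (toℕ r) * D)) ≤ 2
at-most-two k (suc d) x _ = begin
    count k (λ r → (toℕ r * D ≤ᵇ x) ∧ (x ≤ᵇ suc (toℕ r) * D))   ≤⟨ count-mono k candidate ⟩
    count k (λ r → (toℕ r ≡ᵇ q) ∨ (suc (toℕ r) ≡ᵇ q))           ≤⟨ count-∨ k (λ r → toℕ r ≡ᵇ q) (λ r → suc (toℕ r) ≡ᵇ q) ⟩
    count k (λ r → toℕ r ≡ᵇ q) + count k (λ r → suc (toℕ r) ≡ᵇ q)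
                                                               ≤⟨ +-mono-≤ (count-index≤1 k q) (count-successor≤1 k q) ⟩
    2                                                          ∎
  where
  open ≤-Reasoning
  D = suc d
  q = x / D
  candidate : ∀ r → T ((toℕ r * D ≤ᵇ x) ∧ (x ≤ᵇ suc (toℕ r) * D)) → T ((toℕ r ≡ᵇ q) ∨ (suc (toℕ r) ≡ᵇ q))
  candidate r h = decide (m≤n⇒m<n∨m≡n r≤q)
    where
    lower : toℕ r * D ≤ x
    lower = ≤ᵇ⇒≤ _ _ (proj₁ (to T-∧ h))
    upper : x ≤ suc (toℕ r) * D
    upper = ≤ᵇ⇒≤ _ _ (proj₂ (to T-∧ h))
    r≤q : toℕ r ≤ q
    r≤q = ≤-trans (≤-reflexive (sym (m*n/n≡m (toℕ r) D))) (/-monoˡ-≤ D lower)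
    q≤1+r : q ≤ suc (toℕ r)
    q≤1+r = ≤-trans (/-monoˡ-≤ D upper) (≤-reflexive (m*n/n≡m (suc (toℕ r)) D))
    decide : toℕ r < q ⊎ toℕ r ≡ q → T ((toℕ r ≡ᵇ q) ∨ (suc (toℕ r) ≡ᵇ q))
    decide (inj₂ r≡q) = from T-∨ (inj₁ (≡⇒≡ᵇ _ _ r≡q))
    decide (inj₁ r<q) = from T-∨ (inj₂ (≡⇒≡ᵇ _ _ (≤-antisym r<q q≤1+r)))

prodF-multiple : ∀ k (f : Fin k → ℕ) i → 0 < f i → Σ ℕ (λ K → prodF k (λ i → f i ⊔ 1) ≡ K * f i)
prodF-multiple k f i f>0 =
  let (K , eq) = prodF-factor k (λ i → f i ⊔ 1) i
  in  K , trans eq (cong (K *_) (m≥n⇒m⊔n≡m {f i} {1} f>0))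

prodF-⊔1-nonZero : ∀ k (f : Fin k → ℕ) → NonZero (prodF k (λ i → f i ⊔ 1))
prodF-⊔1-nonZero k f = prodF-nonZero k _ (λ i → >-nonZero (≤-trans (s≤s z≤n) (m≤n⊔m (f i) 1)))

module Decomposition (m n : ℕ) (A : Matrix m n) (b : Fin m → ℤ) (s : Fin n → ℕ) (sol : IsSolution A b s) where
  open Construction m n A b s sol

  D : ℕ
  D = prodF (suc n) (λ i → s₀ i ⊔ 1) * prodF m (λ j → P j ⊔ 1)

  D>0 : 0 < D
  D>0 = >-nonZero⁻¹ D {{m*n≢0 _ _ {{prodF-⊔1-nonZero (suc n) s₀}} {{prodF-⊔1-nonZero m P}}}}

  class-divides : ∀ i → 0 < s₀ i → Σ ℕ (λ K → D ≡ K * s₀ i)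
  class-divides i s>0 with prodF-multiple (suc n) s₀ i s>0
  ... | K , eq = K * prodF m (λ j → P j ⊔ 1) ,
        trans (cong (_* prodF m (λ j → P j ⊔ 1)) eq) (*-comm-middle K (s₀ i) _)
    where
    *-comm-middle : ∀ x y z → x * y * z ≡ x * z * y
    *-comm-middle x y z = solve 3 (λ x y z → x :* y :* z := x :* z :* y) refl x y z

  constraint-divides : ∀ j → 0 < P j → Σ ℕ (λ K → D ≡ K * P j)
  constraint-divides j P>0 with prodF-multiple m P j P>0
  ... | K , eq = prodF (suc n) (λ i → s₀ i ⊔ 1) * K ,
        trans (cong (prodF (suc n) (λ i → s₀ i ⊔ 1) *_) eq) (sym (*-assoc (prodF (suc n) (λ i → s₀ i ⊔ 1)) K (P j)))

  inBag : ℕ → Vertex → Bool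
  inBag g (i , r) = within? D g (s₀ i) (toℕ r)

  bag : Fin (suc D) → Subset NV
  bag g = Vec.tabulate (λ v → inBag (toℕ g) (vertexOf v))

  ∈-bag⁺ : ∀ g v → T (inBag (toℕ g) (vertexOf v)) → v ∈ bag g
  ∈-bag⁺ g v h = VecP.lookup⇒[]= v (bag g)
    (trans (VecP.lookup∘tabulate (λ v → inBag (toℕ g) (vertexOf v)) v) (T⇒≡true h))

  ∈-bag⁻ : ∀ g v → v ∈ bag g → T (inBag (toℕ g) (vertexOf v))
  ∈-bag⁻ g v h = from T-≡ (trans (sym (VecP.lookup∘tabulate (λ v → inBag (toℕ g) (vertexOf v)) v))
                                  (VecP.[]=⇒lookup h))

  in-bag-at : ∀ t (t≤D : t ≤ D) w → Within D t (s₀ (proj₁ w)) (toℕ (proj₂ w)) →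
              vertex w ∈ bag (fromℕ< (s≤s t≤D))
  in-bag-at t t≤D w h = ∈-bag⁺ (fromℕ< (s≤s t≤D)) (vertex w)
    (subst (λ u → T (inBag (toℕ (fromℕ< (s≤s t≤D))) u)) (sym (vertexOf-vertex w))
      (subst (λ u → T (within? D u (s₀ (proj₁ w)) (toℕ (proj₂ w)))) (sym (FP.toℕ-fromℕ< (s≤s t≤D)))
        (within-intro D t (s₀ (proj₁ w)) (toℕ (proj₂ w)) h)))

  scaled-time : ∀ {Q K} (t : Fin Q) → D ≡ K * Q → toℕ t * K ≤ D
  scaled-time {Q} {K} t D≡KQ = ≤-trans (*-monoˡ-≤ K (<⇒≤ (FP.toℕ<n t))) (≤-reflexive (trans (*-comm Q K) (sym D≡KQ)))

  -- Vertex (i , r) lies in the bag at time r/s_i.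
  vertex-covered : ∀ v → ∃ λ g → v ∈ bag g
  vertex-covered v with vertexOf v | enc-dec (suc n) s₀ v
  ... | (i , r) | refl with class-divides i (≤-<-trans z≤n (FP.toℕ<n r))
  ... | K , D≡Ks = fromℕ< (s≤s (scaled-time r D≡Ks)) , in-bag-at (toℕ r * K) (scaled-time r D≡Ks) (i , r)
                         (subst (λ D′ → Within D′ (toℕ r * K) (s₀ i) (toℕ r)) (sym D≡Ks)
                                (within-scale K (s₀ i) (toℕ r) (s₀ i) (toℕ r) (within-left (s₀ i) (toℕ r))))

  -- Edge (j , p) lies in the bag at time p/P_j, inside both endpoint intervals.
  edge-covered : ∀ x → ∃ λ g → (proj₁ (ends G x) ∈ bag g) × (proj₂ (ends G x) ∈ bag g)
  edge-covered x with dec m P x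
  ... | (j , p) with constraint-divides j (≤-<-trans z≤n (FP.toℕ<n p))
  ... | K , D≡KP = fromℕ< (s≤s (scaled-time p D≡KP)) , at (Pos.owner j p) (Pos.owner-contains j p) , at (Neg.owner j p) (Neg.owner-contains j p)
    where
    at : ∀ w → Within (P j) (toℕ p) (s₀ (proj₁ w)) (toℕ (proj₂ w)) → vertex w ∈ bag (fromℕ< (s≤s (scaled-time p D≡KP)))
    at w h = in-bag-at (toℕ p * K) (scaled-time p D≡KP) w
               (subst (λ D′ → Within D′ (toℕ p * K) (s₀ (proj₁ w)) (toℕ (proj₂ w))) (sym D≡KP)
                      (within-scale K (P j) (toℕ p) (s₀ (proj₁ w)) (toℕ (proj₂ w)) h))

  bags-convex : ∀ v (k₁ k₂ k₃ : Fin (suc D)) → k₁ F.≤ k₂ → k₂ F.≤ k₃ → v ∈ bag k₁ → v ∈ bag k₃ → v ∈ bag k₂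
  bags-convex v k₁ k₂ k₃ k₁≤k₂ k₂≤k₃ v∈₁ v∈₃ with vertexOf v | ∈-bag⁻ k₁ v v∈₁ | ∈-bag⁻ k₃ v v∈₃ | ∈-bag⁺ k₂ v
  ... | (i , r) | h₁ | h₃ | ∈₂ =
    ∈₂ (within-intro D (toℕ k₂) (s₀ i) (toℕ r) (within-between D (s₀ i) (toℕ r) k₁≤k₂ k₂≤k₃
         (within-elim D (toℕ k₁) (s₀ i) (toℕ r) h₁) (within-elim D (toℕ k₃) (s₀ i) (toℕ r) h₃)))

  decomposition : PathDecomposition G
  decomposition = record { L = suc D ; bag = bag ; vcover = vertex-covered ; ecover = edge-covered ; interp = bags-convex }

  -- A bag meets class 0 in at most one vertex and every other class in at most two.
  bag-size : ∀ g → size (bag g) ≤ 2 * n + 1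
  bag-size g = begin
    size (bag g)                                                ≡⟨ size-tabulate NV (λ v → inBag (toℕ g) (vertexOf v)) ⟩
    count NV (λ v → inBag (toℕ g) (vertexOf v))                 ≡⟨ count-Σ (suc n) s₀ (inBag (toℕ g)) ⟩
    sumF (suc n) (λ i → count (s₀ i) (λ r → inBag (toℕ g) (i , r)))
                                                                ≤⟨ +-mono-≤ (count-≤ 1 (λ r → inBag (toℕ g) (zero , r)))
                                                                           (sumF-mono n (λ i → at-most-two (s i) D (toℕ g * s i) D>0)) ⟩
    1 + sumF n (λ _ → 2)                                        ≡⟨ cong (1 +_) (trans (sumF-const n 2) (*-comm n 2)) ⟩
    1 + 2 * n                                                   ≡⟨ +-comm 1 (2 * n) ⟩
    2 * n + 1                                                   ∎
    where open ≤-Reasoning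

mainTheorem1 : (m n : ℕ) (A : Matrix m n) (b : Fin m → ℤ) (s : Fin n → ℕ) →
    IsSolution A b s →
    Σ (LGraph n m) (λ G → InClass A b G × SolIs G s × PathwidthAtMost G (2 * n))
mainTheorem1 m n A b s sol = G , inClass , solution , (decomposition , bag-size)
  where
  open Construction m n A b s sol using (G; inClass; solution)
  open Decomposition m n A b s sol using (decomposition; bag-size)
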